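{- Let $n,b,t$ be positive integers. If $\mathcal{B}\subset\binom{[n]}{b}$ is initial and $\tau(\mathcal{B})\geq t$, then $\binom{[b+t-1]}{b}\subset\mathcal{B}$.
   Context: $[n]=\{1,\dots,n\}$ and $\binom{X}{k}$ is the family of all $k$-element subsets of $X$. For a family $\mathcal{B}$ of nonempty subsets of $[n]$, the covering number $\tau(\mathcal{B})$ is the minimum size of a set $T\subset[n]$ with $T\cap B\neq\emptyset$ for all $B\in\mathcal{B}$. For $1\le i<j\le n$ the shift $S_{ij}$ acts on a set $B$ by $S_{ij}(B)=(B\setminus\{j\})\cup\{i\}$ if $j\in B$, $i\notin B$ and $(B\setminus\{j\})\cup\{i\}\notin\mathcal{B}$, and $S_{ij}(B)=B$ otherwise; $S_{ij}(\mathcal{B})=\{S_{ij}(B):B\in\mathcal{B}\}$. A family $\mathcal{B}$ is initial if $S_{ij}(\mathcal{B})=\mathcal{B}$ for all $1\le i<j\le n$. -}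

module Defs where

open import Data.Nat using (ℕ; _<_; _+_; _∸_; _≤_)
open import Data.Bool using (Bool; true; false)
import Data.Bool.Properties as BoolP
open import Data.Fin using (Fin; toℕ)
open import Data.Fin.Subset using (Subset; _∈_; _∉_; _∪_; _-_; ⁅_⁆; ∣_∣; _∩_; Nonempty)
open import Data.Fin.Subset.Properties using (_∈?_)
open import Data.Vec.Properties using (≡-dec)
open import Data.List using (List; map)
import Data.List.Membership.Propositional as LM
open import Relation.Nullary using (Dec; yes; no; ¬_)
open import Relation.Binary.PropositionalEquality using (_≡_)
open import Data.List.Relation.Unary.Any using (any?)

-- The ground set [n] = {1,…,n} is represented by Fin n (element k ↔ toℕ k + 1).
-- A family 𝓑 of subsets of [n] is a List (Subset n); repetitions are harmless
-- since all notions below only use membership.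

Family : ℕ → Set
Family n = List (Subset n)

_∈𝓕_ : ∀ {n} → Subset n → Family n → Set
B ∈𝓕 𝓑 = B LM.∈ 𝓑

_∈𝓕?_ : ∀ {n} (B : Subset n) (𝓑 : Family n) → Dec (B ∈𝓕 𝓑)
B ∈𝓕? 𝓑 = any? (λ C → ≡-dec BoolP._≟_ B C) 𝓑

Uniform : ∀ {n} → ℕ → Family n → Set
Uniform b 𝓑 = ∀ B → B ∈𝓕 𝓑 → ∣ B ∣ ≡ b

shiftSet : ∀ {n} → Family n → Fin n → Fin n → Subset n → Subset n
shiftSet 𝓑 i j B with j ∈? B | i ∈? B
... | yes _ | no _ with ((B - j) ∪ ⁅ i ⁆) ∈𝓕? 𝓑
...   | no _  = (B - j) ∪ ⁅ i ⁆
...   | yes _ = B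
shiftSet 𝓑 i j B | _ | _ = B

shift : ∀ {n} → Fin n → Fin n → Family n → Family n
shift i j 𝓑 = map (shiftSet 𝓑 i j) 𝓑

_≐_ : ∀ {n} → Family n → Family n → Set
𝓐 ≐ 𝓑 = ∀ B → (B ∈𝓕 𝓐 → B ∈𝓕 𝓑) × (B ∈𝓕 𝓑 → B ∈𝓕 𝓐)
  where open import Data.Product using (_×_)

Initial : ∀ {n} → Family n → Set
Initial 𝓑 = ∀ i j → toℕ i < toℕ j → shift i j 𝓑 ≐ 𝓑

Cover : ∀ {n} → Family n → Subset n → Set
Cover 𝓑 T = ∀ B → B ∈𝓕 𝓑 → Nonempty (T ∩ B)

CoverNumberAtLeast : ∀ {n} → Family n → ℕ → Set
CoverNumberAtLeast 𝓑 t = ∀ T → Cover 𝓑 T → t ≤ ∣ T ∣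

-- B ⊆ [m], i.e. every element of B (as element of [n]) is at most m
WithinFirst : ∀ {n} → ℕ → Subset n → Set
WithinFirst m B = ∀ x → x ∈ B → toℕ x < m

{-# OPTIONS --safe #-}
-- Suppose B ⊆ [b+t-1] has b elements but B ∉ 𝓑. Then T = [b+t-1] ∖ B, of size t - 1,
-- is a cover: a member C of 𝓑 missing T has all of C ∖ B above all of B, so shifting the
-- elements of C ∖ B one by one onto B ∖ C stays inside the initial family 𝓑 and ends at
-- B, since |C| = |B|. Hence τ(𝓑) ≤ t - 1.
module Submission where

open import Defs
open import Data.Nat using (ℕ; zero; suc; _+_; _∸_; _≤_; _<_; z≤n; s≤s; _<?_)
open import Data.Nat.Properties
  using (+-suc; +-comm; +-monoˡ-≤; ≤-reflexive; <-irrefl; <-≤-trans; ≮⇒≥; module ≤-Reasoning)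
open import Data.Nat.Induction using (<-wellFounded)
open import Data.Fin using (Fin; zero; suc; toℕ)
open import Data.Fin.Properties using (¬∀⟶∃¬)
open import Data.Fin.Subset
  using (Subset; inside; outside; _∈_; _∉_; _⊆_; _─_; _-_; _∪_; _∩_; ⁅_⁆; ⊥; ∣_∣)
open import Data.Fin.Subset.Properties
  using ( _∈?_; _⊆?_; ⊆-reflexive; ⊆-antisym; drop-∷-⊆; ∣⊥∣≡0; p⊂q⇒∣p∣<∣q∣; nonempty?
        ; x∈p∩q⁺; x∈p∪q⁻; x∈p∧x∉q⇒x∈p─q; x∈⁅x⁆; x∈⁅y⁆⇒x≡y )
open import Data.Vec using ([]; _∷_; here; there)
open import Data.List.Membership.Propositional.Properties using (∈-map⁺)
open import Data.Product using (∃; _×_; _,_; proj₁)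
open import Data.Sum using (_⊎_; inj₁; inj₂)
open import Data.Empty using (⊥-elim)
open import Induction.WellFounded using (Acc; acc)
open import Relation.Nullary using (¬_; yes; no; contradiction)
open import Relation.Nullary.Decidable using (_→-dec_)
open import Relation.Binary.PropositionalEquality using (_≡_; _≢_; refl; sym; trans; cong; subst)

private
  variable
    n : ℕ
    p q : Subset n
    x : Fin n

x∈p─q⁻ : ∀ (p q : Subset n) → x ∈ p ─ q → x ∈ p × x ∉ q
x∈p─q⁻ (_ ∷ p) (outside ∷ q) here      = here , λ ()
x∈p─q⁻ (_ ∷ p) (_       ∷ q) (there x∈p─q) with x∈p─q⁻ p q x∈p─q
... | x∈p , x∉q = there x∈p , λ { (there x∈q) → x∉q x∈q }

⊈⇒∃∈∉ : ¬ p ⊆ q → ∃ λ x → x ∈ p × x ∉ q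
⊈⇒∃∈∉ {n} {p} {q} p⊈q
  with ¬∀⟶∃¬ n (λ x → x ∈ p → x ∈ q) (λ x → x ∈? p →-dec x ∈? q) (λ p⊆q → p⊈q (p⊆q _))
... | x , x∈p↛x∈q with x ∈? p
...   | yes x∈p = x , x∈p , λ x∈q → x∈p↛x∈q (λ _ → x∈q)
...   | no  x∉p = ⊥-elim (x∈p↛x∈q (λ x∈p → contradiction x∈p x∉p))

p⊆q∧∣p∣≡∣q∣⇒p≡q : p ⊆ q → ∣ p ∣ ≡ ∣ q ∣ → p ≡ q
p⊆q∧∣p∣≡∣q∣⇒p≡q {p = p} {q} p⊆q ∣p∣≡∣q∣ with q ⊆? p
... | yes q⊆p = ⊆-antisym p⊆q q⊆p
... | no  q⊈p with ⊈⇒∃∈∉ q⊈p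
...   | x , x∈q , x∉p = contradiction (p⊂q⇒∣p∣<∣q∣ (p⊆q , x , x∈q , x∉p)) (<-irrefl ∣p∣≡∣q∣)

q⊆p⇒∣p─q∣+∣q∣≡∣p∣ : ∀ (p q : Subset n) → q ⊆ p → ∣ p ─ q ∣ + ∣ q ∣ ≡ ∣ p ∣
q⊆p⇒∣p─q∣+∣q∣≡∣p∣ []            []            _   = refl
q⊆p⇒∣p─q∣+∣q∣≡∣p∣ (outside ∷ p) (inside  ∷ q) q⊆p with () ← q⊆p here
q⊆p⇒∣p─q∣+∣q∣≡∣p∣ (inside  ∷ p) (inside  ∷ q) q⊆p =
  trans (+-suc ∣ p ─ q ∣ ∣ q ∣) (cong suc (q⊆p⇒∣p─q∣+∣q∣≡∣p∣ p q (drop-∷-⊆ q⊆p)))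
q⊆p⇒∣p─q∣+∣q∣≡∣p∣ (inside  ∷ p) (outside ∷ q) q⊆p = cong suc (q⊆p⇒∣p─q∣+∣q∣≡∣p∣ p q (drop-∷-⊆ q⊆p))
q⊆p⇒∣p─q∣+∣q∣≡∣p∣ (outside ∷ p) (outside ∷ q) q⊆p = q⊆p⇒∣p─q∣+∣q∣≡∣p∣ p q (drop-∷-⊆ q⊆p)

initialSegment : ℕ → Subset n
initialSegment {zero}  _       = []
initialSegment {suc n} zero    = ⊥
initialSegment {suc n} (suc m) = inside ∷ initialSegment m

∣initialSegment∣≤ : ∀ n m → ∣ initialSegment {n} m ∣ ≤ m
∣initialSegment∣≤ zero    m       = z≤n
∣initialSegment∣≤ (suc n) zero    = ≤-reflexive (∣⊥∣≡0 (suc n))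
∣initialSegment∣≤ (suc n) (suc m) = s≤s (∣initialSegment∣≤ n m)

<⇒∈initialSegment : ∀ {m} → toℕ x < m → x ∈ initialSegment m
<⇒∈initialSegment {x = zero}  {suc m} _         = here
<⇒∈initialSegment {x = suc x} {suc m} (s≤s x<m) = there (<⇒∈initialSegment x<m)

infix 4 _≪_

_≪_ : Subset n → Subset n → Set
p ≪ q = ∀ {x y} → x ∈ p → y ∈ q → toℕ x < toℕ y

shifted : Fin n → Fin n → Subset n → Subset n
shifted i j C = (C - j) ∪ ⁅ i ⁆

x∈shifted⁻ : ∀ i j (C : Subset n) → x ∈ shifted i j C → (x ∈ C × x ≢ j) ⊎ x ≡ i
x∈shifted⁻ i j C x∈C′ with x∈p∪q⁻ (C - j) ⁅ i ⁆ x∈C′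
... | inj₂ x∈⁅i⁆ = inj₂ (x∈⁅y⁆⇒x≡y i x∈⁅i⁆)
... | inj₁ x∈C-j with x∈p─q⁻ C ⁅ j ⁆ x∈C-j
...   | x∈C , x∉⁅j⁆ = inj₁ (x∈C , λ { refl → x∉⁅j⁆ (x∈⁅x⁆ j) })

shiftSet-moves : ∀ (𝓑 : Family n) i j C → j ∈ C → i ∉ C → ¬ shifted i j C ∈𝓕 𝓑 →
                 shiftSet 𝓑 i j C ≡ shifted i j C
shiftSet-moves 𝓑 i j C j∈C i∉C C′∉𝓑 with j ∈? C | i ∈? C
... | no  j∉C | _       = contradiction j∈C j∉C
... | yes _   | yes i∈C = contradiction i∈C i∉C
... | yes _   | no  _ with shifted i j C ∈𝓕? 𝓑
...   | yes C′∈𝓑 = contradiction C′∈𝓑 C′∉𝓑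
...   | no  _    = refl

Initial⇒shifted∈ : ∀ {𝓑 : Family n} → Initial 𝓑 → ∀ {i j C} → toℕ i < toℕ j →
                   C ∈𝓕 𝓑 → j ∈ C → i ∉ C → shifted i j C ∈𝓕 𝓑
Initial⇒shifted∈ {𝓑 = 𝓑} initial {i} {j} {C} i<j C∈𝓑 j∈C i∉C with shifted i j C ∈𝓕? 𝓑
... | yes C′∈𝓑 = C′∈𝓑
... | no  C′∉𝓑 = proj₁ (initial i j i<j (shifted i j C))
  (subst (_∈𝓕 shift i j 𝓑) (shiftSet-moves 𝓑 i j C j∈C i∉C C′∉𝓑) (∈-map⁺ (shiftSet 𝓑 i j) C∈𝓑))

module _ {b} {𝓑 : Family n} (uniform : Uniform b 𝓑) (initial : Initial 𝓑)
         {B : Subset n} (∣B∣≡b : ∣ B ∣ ≡ b) where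

  ≪-difference⇒∈ : ∀ {C} → Acc _<_ ∣ C ─ B ∣ → C ∈𝓕 𝓑 → B ≪ C ─ B → B ∈𝓕 𝓑
  ≪-difference⇒∈ {C} (acc smaller) C∈𝓑 B≪C─B with B ⊆? C | C ⊆? B
  ... | yes B⊆C | _ = subst (_∈𝓕 𝓑) (sym (p⊆q∧∣p∣≡∣q∣⇒p≡q B⊆C ∣B∣≡∣C∣)) C∈𝓑
    where
    ∣B∣≡∣C∣ : ∣ B ∣ ≡ ∣ C ∣
    ∣B∣≡∣C∣ = trans ∣B∣≡b (sym (uniform C C∈𝓑))
  ... | no  B⊈C | yes C⊆B = ⊥-elim (B⊈C (⊆-reflexive (sym (p⊆q∧∣p∣≡∣q∣⇒p≡q C⊆B ∣C∣≡∣B∣))))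
    where
    ∣C∣≡∣B∣ : ∣ C ∣ ≡ ∣ B ∣
    ∣C∣≡∣B∣ = trans (uniform C C∈𝓑) (sym ∣B∣≡b)
  ... | no  B⊈C | no  C⊈B with ⊈⇒∃∈∉ B⊈C | ⊈⇒∃∈∉ C⊈B
  ...   | i , i∈B , i∉C | j , j∈C , j∉B =
    ≪-difference⇒∈ (smaller ∣C′─B∣<∣C─B∣) (Initial⇒shifted∈ initial i<j C∈𝓑 j∈C i∉C)
                   (λ x∈B y∈C′─B → B≪C─B x∈B (C′─B⊆C─B y∈C′─B))
    where
    C′ : Subset n
    C′ = shifted i j C

    j∈C─B : j ∈ C ─ B
    j∈C─B = x∈p∧x∉q⇒x∈p─q j∈C j∉B

    i<j : toℕ i < toℕ j
    i<j = B≪C─B i∈B j∈C─B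

    C′─B⊆C─B : C′ ─ B ⊆ C ─ B
    C′─B⊆C─B x∈C′─B with x∈p─q⁻ C′ B x∈C′─B
    ... | x∈C′ , x∉B with x∈shifted⁻ i j C x∈C′
    ...   | inj₁ (x∈C , _) = x∈p∧x∉q⇒x∈p─q x∈C x∉B
    ...   | inj₂ refl      = contradiction i∈B x∉B

    j∉C′─B : j ∉ C′ ─ B
    j∉C′─B j∈C′─B with x∈shifted⁻ i j C (proj₁ (x∈p─q⁻ C′ B j∈C′─B))
    ... | inj₁ (_ , j≢j) = j≢j refl
    ... | inj₂ refl      = <-irrefl refl i<j

    ∣C′─B∣<∣C─B∣ : ∣ C′ ─ B ∣ < ∣ C ─ B ∣
    ∣C′─B∣<∣C─B∣ = p⊂q⇒∣p∣<∣q∣ (C′─B⊆C─B , j , j∈C─B , j∉C′─B)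

  ∉⇒initialSegment─B-covers : ∀ {m} → WithinFirst m B → ¬ B ∈𝓕 𝓑 → Cover 𝓑 (initialSegment m ─ B)
  ∉⇒initialSegment─B-covers {m} B⊆[m] B∉𝓑 C C∈𝓑 with nonempty? ((initialSegment m ─ B) ∩ C)
  ... | yes meets = meets
  ... | no  misses = contradiction (≪-difference⇒∈ (<-wellFounded _) C∈𝓑 B≪C─B) B∉𝓑
    where
    B≪C─B : B ≪ C ─ B
    B≪C─B {x} {y} x∈B y∈C─B with x∈p─q⁻ C B y∈C─B | toℕ y <? m
    ... | y∈C , y∉B | yes y<m =
      contradiction (y , x∈p∩q⁺ (x∈p∧x∉q⇒x∈p─q (<⇒∈initialSegment y<m) y∉B , y∈C)) misses
    ... | _ | no y≮m = <-≤-trans (B⊆[m] x x∈B) (≮⇒≥ y≮m)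

proposition4 : (n b t : ℕ) → 0 < n → 0 < b → 0 < t →
    (𝓑 : Family n) → Uniform b 𝓑 → Initial 𝓑 → CoverNumberAtLeast 𝓑 t →
    (B : Subset n) → ∣ B ∣ ≡ b → WithinFirst (b + t ∸ 1) B → B ∈𝓕 𝓑
proposition4 _ _ zero    _ _ () _ _ _ _ _ _ _
proposition4 n b (suc t) _ _ _ 𝓑 uniform initial τ≥t+1 B ∣B∣≡b B⊆[m] with B ∈𝓕? 𝓑
... | yes B∈𝓑 = B∈𝓑
... | no  B∉𝓑 = ⊥-elim (<-irrefl refl b+t<b+t)
  where
  open ≤-Reasoning

  m : ℕ
  m = b + suc t ∸ 1

  T : Subset n
  T = initialSegment m ─ B

  T-covers : Cover 𝓑 T
  T-covers = ∉⇒initialSegment─B-covers uniform initial ∣B∣≡b B⊆[m] B∉𝓑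

  B⊆segment : B ⊆ initialSegment m
  B⊆segment x∈B = <⇒∈initialSegment (B⊆[m] _ x∈B)

  b+t<b+t : b + t < b + t
  b+t<b+t = begin-strict
    b + t                    ≡⟨ +-comm b t ⟩
    t + b                    <⟨ +-monoˡ-≤ b (τ≥t+1 T T-covers) ⟩
    ∣ T ∣ + b                ≡⟨ cong (∣ T ∣ +_) (sym ∣B∣≡b) ⟩
    ∣ T ∣ + ∣ B ∣            ≡⟨ q⊆p⇒∣p─q∣+∣q∣≡∣p∣ (initialSegment m) B B⊆segment ⟩
    ∣ initialSegment {n} m ∣ ≤⟨ ∣initialSegment∣≤ n m ⟩
    m                        ≡⟨ cong (_∸ 1) (+-suc b t) ⟩
    b + t                    ∎
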